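{- Let $\ell\ge1$, $m=2\ell$, and let $S_1,\dots,S_n$ be DNA words of length $\ell$ with $\mathcal{W}_{\max}=\max_i\mathrm{FE}(S_i)$. Let $\hat S^1,\dots,\hat S^{4^m}$ be all DNA strings of length $m$ ordered so that $\mathrm{FE}(\hat S^1)\le\cdots\le\mathrm{FE}(\hat S^{4^m})$, $\Delta=\max_{1\le i<4^m}\{\mathrm{FE}(\hat S^{i+1})-\mathrm{FE}(\hat S^i)\}$, $\alpha=\mathcal{W}_{\max}+\mathrm{FE}(\hat S^1)$, $\beta=\alpha+\Delta$. For each $i$ let $\hat S_{j(i)}$ be a DNA string of length $m$ with $\alpha\le\mathrm{FE}(S_i)+\mathrm{FE}(\hat S_{j(i)})\le\beta$, and let $W_i'=S_i\otimes\hat S_{j(i)}$. Then for all $i$, $\alpha-D\le\mathrm{FE}(W_i')\le\beta+D+\Gamma_{\max}$.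
   Context: DNA strings are over $\Pi_D=\{A,C,G,T\}$. Fix a pairwise energy table $\Gamma:\Pi_D\times\Pi_D\to\mathbb{Z}_{\ge0}$ (nonnegative integer entries), with $\Gamma_{\max}$ and $\Gamma_{\min}$ its largest and smallest entries and $D=\Gamma_{\max}-\Gamma_{\min}$. The free energy of $X=x_1\cdots x_\ell$ is $\mathrm{FE}(X)=\sum_{i=1}^{\ell-1}\Gamma_{x_i,x_{i+1}}$. For strings $X$ of length $\ell_X$ and $Y$ of even length $\ell_Y$, $X\otimes Y$ denotes the string $Y[1..(\ell_Y/2)]\,X[1..\ell_X]\,Y[(\ell_Y/2+1)..\ell_Y]$. -}

module Defs where

open import Data.Nat using (ℕ; zero; suc; _+_; _∸_; _⊔_; _⊓_)
open import Data.Nat.Properties using (≤-decTotalOrder)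
open import Data.List using (List; []; _∷_; map; foldr; concatMap)
open import Data.Vec using (Vec; []; _∷_; toList; _++_; splitAt)
open import Data.Fin using (Fin)
open import Data.Product using (_,_; proj₁; proj₂)
import Data.List.Sort as Sort

data Base : Set where
  A C G T : Base

bases : List Base
bases = A ∷ C ∷ G ∷ T ∷ []

Table : Set
Table = Base → Base → ℕ

entries : Table → List ℕ
entries Γ = concatMap (λ x → map (Γ x) bases) bases

Γmax : Table → ℕ
Γmax Γ = foldr _⊔_ 0 (entries Γ)

Γmin : Table → ℕ
Γmin Γ = foldr _⊓_ (Γ A A) (entries Γ)

Dof : Table → ℕ
Dof Γ = Γmax Γ ∸ Γmin Γ

FEL : Table → List Base → ℕ
FEL Γ (x ∷ y ∷ xs) = Γ x y + FEL Γ (y ∷ xs)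
FEL Γ _ = 0

FE : Table → {k : ℕ} → Vec Base k → ℕ
FE Γ v = FEL Γ (toList v)

_⊗_ : {ℓX k : ℕ} → Vec Base ℓX → Vec Base (k + k) → Vec Base (k + (ℓX + k))
_⊗_ {k = k} X Y with splitAt k Y
... | (Y₁ , Y₂ , _) = Y₁ ++ (X ++ Y₂)

allStrings : (m : ℕ) → List (Vec Base m)
allStrings zero = [] ∷ []
allStrings (suc m) = concatMap (λ b → map (b ∷_) (allStrings m)) bases

open Sort ≤-decTotalOrder using (sort)

sortedFEs : Table → (m : ℕ) → List ℕ
sortedFEs Γ m = sort (map (FE Γ) (allStrings m))

-- FE(Ŝ^1): first element of the sorted list (list is never empty)
headOr0 : List ℕ → ℕ
headOr0 [] = 0
headOr0 (x ∷ _) = x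

minFE : Table → ℕ → ℕ
minFE Γ m = headOr0 (sortedFEs Γ m)

gaps : List ℕ → List ℕ
gaps (x ∷ y ∷ xs) = (y ∸ x) ∷ gaps (y ∷ xs)
gaps _ = []

Δof : Table → ℕ → ℕ
Δof Γ m = foldr _⊔_ 0 (gaps (sortedFEs Γ m))

Wmax : Table → {n ℓ : ℕ} → (Fin n → Vec Base ℓ) → ℕ
Wmax Γ {n} S = foldr _⊔_ 0 (map (λ i → FE Γ (S i)) (Data.List.allFin n))
  where import Data.List

-- Splicing X into the middle of Y destroys the junction between the two halves of Y and
-- creates the two junctions at the ends of X, so FE(X ⊗ Y) + Γ(u,v) = FE(X) + FE(Y) + Γ(u,x₁) + Γ(x_ℓ,v).
-- Any two entries of Γ differ by at most D and every entry is at most Γ_max, which turns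
-- α ≤ FE(X) + FE(Y) ≤ β into the stated bounds.
module Submission where

open import Defs
open import Data.Nat using (ℕ; suc; _+_; _≤_; _⊔_; _⊓_)
open import Data.Nat.Properties
open import Data.Fin using (Fin)
open import Data.Vec using (Vec; []; _∷_; _++_; head; last; splitAt)
open import Data.List using (List; foldr; map) renaming (_∷_ to _∷ˡ_)
open import Data.List.Membership.Propositional using (_∈_)
open import Data.List.Membership.Propositional.Properties using (∈-map⁺; ∈-concatMap⁺)
open import Data.List.Relation.Unary.Any using (here; there)
import Data.List.Relation.Unary.Any as Any
open import Data.Product using (_×_; _,_; ∃₂)
open import Relation.Binary.PropositionalEquality
open import Data.Nat.Tactic.RingSolver using (solve-∀)

∈⇒≤foldr-⊔ : ∀ {v} (xs : List ℕ) → v ∈ xs → v ≤ foldr _⊔_ 0 xs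
∈⇒≤foldr-⊔ (x ∷ˡ xs) (here refl) = m≤m⊔n x _
∈⇒≤foldr-⊔ (x ∷ˡ xs) (there v∈xs) = ≤-trans (∈⇒≤foldr-⊔ xs v∈xs) (m≤n⊔m x _)

∈⇒foldr-⊓≤ : ∀ {v} b (xs : List ℕ) → v ∈ xs → foldr _⊓_ b xs ≤ v
∈⇒foldr-⊓≤ b (x ∷ˡ xs) (here refl) = m⊓n≤m x _
∈⇒foldr-⊓≤ b (x ∷ˡ xs) (there v∈xs) = ≤-trans (m⊓n≤n x _) (∈⇒foldr-⊓≤ b xs v∈xs)

∈-bases : ∀ x → x ∈ bases
∈-bases A = here refl
∈-bases C = there (here refl)
∈-bases G = there (there (here refl))
∈-bases T = there (there (there (here refl)))

module _ (Γ : Table) where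

  ∈-entries : ∀ x y → Γ x y ∈ entries Γ
  ∈-entries x y = ∈-concatMap⁺ (λ b → map (Γ b) bases) (Any.map (λ { refl → ∈-map⁺ (Γ x) (∈-bases y) }) (∈-bases x))

  entry≤Γmax : ∀ x y → Γ x y ≤ Γmax Γ
  entry≤Γmax x y = ∈⇒≤foldr-⊔ (entries Γ) (∈-entries x y)

  Γmin≤entry : ∀ x y → Γmin Γ ≤ Γ x y
  Γmin≤entry x y = ∈⇒foldr-⊓≤ (Γ A A) (entries Γ) (∈-entries x y)

  entry≤entry+D : ∀ x y x′ y′ → Γ x y ≤ Γ x′ y′ + Dof Γ
  entry≤entry+D x y x′ y′ = begin
    Γ x y                    ≤⟨ entry≤Γmax x y ⟩
    Γmax Γ                   ≤⟨ m≤n+m∸n (Γmax Γ) (Γmin Γ) ⟩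
    Γmin Γ + Dof Γ           ≤⟨ +-monoˡ-≤ (Dof Γ) (Γmin≤entry x′ y′) ⟩
    Γ x′ y′ + Dof Γ          ∎
    where open ≤-Reasoning

  FE-++ : ∀ {m n} (xs : Vec Base (suc m)) (ys : Vec Base (suc n)) →
          FE Γ (xs ++ ys) ≡ FE Γ xs + Γ (last xs) (head ys) + FE Γ ys
  FE-++ (x ∷ []) (y ∷ ys) = refl
  FE-++ (x ∷ x′ ∷ xs) ys = begin
    Γ x x′ + FE Γ ((x′ ∷ xs) ++ ys)
      ≡⟨ cong (Γ x x′ +_) (FE-++ (x′ ∷ xs) ys) ⟩
    Γ x x′ + (FE Γ (x′ ∷ xs) + Γ (last (x′ ∷ xs)) (head ys) + FE Γ ys)
      ≡⟨ +-assoc (Γ x x′) _ _ ⟨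
    Γ x x′ + (FE Γ (x′ ∷ xs) + Γ (last (x′ ∷ xs)) (head ys)) + FE Γ ys
      ≡⟨ cong (_+ FE Γ ys) (+-assoc (Γ x x′) _ _) ⟨
    Γ x x′ + FE Γ (x′ ∷ xs) + Γ (last (x′ ∷ xs)) (head ys) + FE Γ ys ∎
    where open ≡-Reasoning

  FE-splice : ∀ {a m b} (Y₁ : Vec Base (suc a)) (X : Vec Base (suc m)) (Y₂ : Vec Base (suc b)) →
              FE Γ (Y₁ ++ (X ++ Y₂)) + Γ (last Y₁) (head Y₂)
                ≡ FE Γ X + FE Γ (Y₁ ++ Y₂) + Γ (last Y₁) (head X) + Γ (last X) (head Y₂)
  FE-splice Y₁ X@(_ ∷ _) Y₂ = begin
    FE Γ (Y₁ ++ (X ++ Y₂)) + g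
      ≡⟨ cong (_+ g) (trans (FE-++ Y₁ (X ++ Y₂)) (cong (FE Γ Y₁ + h₁ +_) (FE-++ X Y₂))) ⟩
    FE Γ Y₁ + h₁ + (FE Γ X + h₂ + FE Γ Y₂) + g
      ≡⟨ rearrange (FE Γ Y₁) h₁ (FE Γ X) h₂ (FE Γ Y₂) g ⟩
    FE Γ X + (FE Γ Y₁ + g + FE Γ Y₂) + h₁ + h₂
      ≡⟨ cong (λ e → FE Γ X + e + h₁ + h₂) (FE-++ Y₁ Y₂) ⟨
    FE Γ X + FE Γ (Y₁ ++ Y₂) + h₁ + h₂ ∎
    where
    open ≡-Reasoning
    g = Γ (last Y₁) (head Y₂)
    h₁ = Γ (last Y₁) (head X)
    h₂ = Γ (last X) (head Y₂)
    rearrange : ∀ p h₁ f h₂ r g → p + h₁ + (f + h₂ + r) + g ≡ f + (p + g + r) + h₁ + h₂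
    rearrange = solve-∀

  FE-⊗ : ∀ {m k} (X : Vec Base (suc m)) (Y : Vec Base (suc k + suc k)) →
         ∃₂ λ u v → FE Γ (_⊗_ {k = suc k} X Y) + Γ u v
                      ≡ FE Γ X + FE Γ Y + Γ u (head X) + Γ (last X) v
  FE-⊗ {k = k} X Y with splitAt (suc k) Y
  ... | Y₁ , Y₂ , refl = last Y₁ , head Y₂ , FE-splice Y₁ X Y₂

splice-lower : ∀ {W E g h₁ h₂ D} → W + g ≡ E + h₁ + h₂ → g ≤ h₁ + D → E ≤ W + D
splice-lower {W} {E} {g} {h₁} {h₂} {D} eq g≤h₁+D = +-cancelʳ-≤ h₁ E (W + D) (begin
  E + h₁             ≤⟨ m≤m+n (E + h₁) h₂ ⟩
  E + h₁ + h₂        ≡⟨ eq ⟨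
  W + g              ≤⟨ +-monoʳ-≤ W g≤h₁+D ⟩
  W + (h₁ + D)       ≡⟨ rearrange W h₁ D ⟩
  W + D + h₁         ∎)
  where
  open ≤-Reasoning
  rearrange : ∀ w h d → w + (h + d) ≡ w + d + h
  rearrange = solve-∀

splice-upper : ∀ {W E g h₁ h₂ D M} → W + g ≡ E + h₁ + h₂ → h₁ ≤ g + D → h₂ ≤ M → W ≤ E + D + M
splice-upper {W} {E} {g} {h₁} {h₂} {D} {M} eq h₁≤g+D h₂≤M = +-cancelʳ-≤ g W (E + D + M) (begin
  W + g              ≡⟨ eq ⟩
  E + h₁ + h₂        ≤⟨ +-mono-≤ (+-monoʳ-≤ E h₁≤g+D) h₂≤M ⟩
  E + (g + D) + M    ≡⟨ rearrange E g D M ⟩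
  E + D + M + g      ∎)
  where
  open ≤-Reasoning
  rearrange : ∀ e g d m → e + (g + d) + m ≡ e + d + m + g
  rearrange = solve-∀

lemma4 : (Γ : Table) (ℓ n : ℕ) → 1 ≤ ℓ →
    (S : Fin n → Vec Base ℓ) →
    (Ŝ : Fin n → Vec Base (ℓ + ℓ)) →
    let α = Wmax Γ S + minFE Γ (ℓ + ℓ)
        β = α + Δof Γ (ℓ + ℓ)
    in (∀ i → α ≤ FE Γ (S i) + FE Γ (Ŝ i) × FE Γ (S i) + FE Γ (Ŝ i) ≤ β) →
       ∀ i → α ≤ FE Γ (_⊗_ {k = ℓ} (S i) (Ŝ i)) + Dof Γ
           × FE Γ (_⊗_ {k = ℓ} (S i) (Ŝ i)) ≤ β + Dof Γ + Γmax Γ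
lemma4 Γ (suc l) n _ S Ŝ bounds i with bounds i | FE-⊗ Γ (S i) (Ŝ i)
... | α≤E , E≤β | u , v , eq =
  ≤-trans α≤E (splice-lower eq (entry≤entry+D Γ u v u (head (S i)))) ,
  ≤-trans (splice-upper eq (entry≤entry+D Γ u (head (S i)) u v) (entry≤Γmax Γ (last (S i)) v))
          (+-monoˡ-≤ (Γmax Γ) (+-monoˡ-≤ (Dof Γ) E≤β))
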